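{- Let $q=p^h$ with $p$ prime, let $m\geq 2$, and let $f\colon \mathbb{F}_q^{m-1}\to\mathbb{F}_q$ be an $\mathbb{F}_p$-linear map. In $V=\mathbb{F}_q^{m+1}$ put \[U=\{(x_0,\dots,x_{m-2},f(x_0,\dots,x_{m-2}),y): x_0,\dots,x_{m-2}\in\mathbb{F}_q,\ y\in\mathbb{F}_p\},\] \[W=\{(x_0,\dots,x_{m-2},y,0): x_0,\dots,x_{m-2}\in\mathbb{F}_q,\ y\in\mathbb{F}_p\}.\] Let $\mathcal{M}=(L_U\triangle L_W,\mu)$ be the multiset of $\mathrm{PG}(m,q)$ with $\mu(x)=1$ for $x\in L_U\setminus L_W$ and $\mu(x)=p-1$ for $x\in L_W\setminus L_U$. Then: (1) there is a hyperplane of $\mathrm{PG}(m,q)$ containing no point of $L_U\triangle L_W$; (2) $|\mathcal{M}|=(p-1)(q^{m-1}+q^{m-2})+q^{m-2}$ if and only if $|L_U\cap L_W|=q^{m-2}\frac{q-1}{p-1}+\frac{q^{m-2}-1}{q-1}$.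
   Context: For an $\mathbb{F}_p$-subspace $W$ of $V=\mathbb{F}_q^{m+1}$ (viewed as an $\mathbb{F}_p$-space), $L_W=\{\langle w\rangle_{\mathbb{F}_q}: w\in W\setminus\{0\}\}$ is the set of points of $\mathrm{PG}(m,q)$ spanned by nonzero vectors of $W$ (an $\mathbb{F}_p$-linear set). A multiset $\mathcal{M}=(\mathcal{S},\mu)$ consists of a nonempty point set $\mathcal{S}$ and a multiplicity function $\mu:\mathcal{S}\to\mathbb{Z}^+$; its size is $|\mathcal{M}|=\sum_{x\in\mathcal{S}}\mu(x)$. -}

module Defs where

open import Level using (0ℓ)
open import Data.Nat as ℕ using (ℕ; zero; suc)
open import Data.Nat.DivMod using (_/_)
open import Data.Product using (Σ; ∃; _×_; _,_)
open import Data.Sum using (_⊎_)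
open import Data.Empty using (⊥)
open import Data.List using (List; length)
open import Data.List.Membership.Propositional using (_∈_)
open import Data.List.Relation.Unary.Unique.Propositional using (Unique)
open import Data.Vec using (Vec; []; _∷_; _++_; zipWith; map; replicate; foldr)
open import Relation.Binary.PropositionalEquality using (_≡_; _≢_)
open import Relation.Binary.Definitions using (DecidableEquality)
open import Relation.Nullary using (¬_)
open import Function.Bundles using (_⇔_)
open import Algebra.Structures using (IsCommutativeRing)

-- Natural-number division with the convention a div 0 = 0 (only used with
-- nonzero divisors in the statement).
_div_ : ℕ → ℕ → ℕ
a div zero = 0
a div suc b = a / suc b

record FiniteField : Set₁ where
  field
    Carrier  : Set
    _+_ _*_  : Carrier → Carrier → Carrier
    -_       : Carrier → Carrier
    0# 1#    : Carrier
    isCommutativeRing : IsCommutativeRing _≡_ _+_ _*_ -_ 0# 1#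
    0≢1      : 0# ≢ 1#
    inverse  : ∀ x → x ≢ 0# → ∃ λ y → x * y ≡ 1#
    _≟_      : DecidableEquality Carrier
    elements : List Carrier
    complete : ∀ x → x ∈ elements
    unique   : Unique elements

  order : ℕ
  order = length elements

  _×1 : ℕ → Carrier
  zero ×1 = 0#
  suc k ×1 = 1# + (k ×1)

  InPrimeField : Carrier → Set
  InPrimeField y = ∃ λ k → y ≡ k ×1

  _⊕_ : ∀ {k} → Vec Carrier k → Vec Carrier k → Vec Carrier k
  _⊕_ = zipWith _+_

  _·_ : ∀ {k} → Carrier → Vec Carrier k → Vec Carrier k
  c · v = map (c *_) v

  0v : ∀ {k} → Vec Carrier k
  0v = replicate _ 0#

  dot : ∀ {k} → Vec Carrier k → Vec Carrier k → Carrier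
  dot u v = foldr _ _+_ 0# (zipWith _*_ u v)

  IsFpLinear : ∀ {k} → (Vec Carrier k → Carrier) → Set
  IsFpLinear f = (∀ u v → f (u ⊕ v) ≡ f u + f v)
               × (∀ c u → InPrimeField c → f (c · u) ≡ c * f u)

  -- Points of PG(k-1,q) are represented by their unique normalized
  -- representative: a nonzero vector whose first nonzero coordinate is 1.
  Normalized : ∀ {k} → Vec Carrier k → Set
  Normalized [] = ⊥
  Normalized (x ∷ v) = (x ≡ 1#) ⊎ ((x ≡ 0#) × Normalized v)

  -- The F_p-linear set L_W determined by a subset W of F_q^k:
  -- the points ⟨w⟩_{F_q} with w ∈ W \ {0}.
  InLinearSet : ∀ {k} → (Vec Carrier k → Set) → Vec Carrier k → Set
  InLinearSet W v = Normalized v ×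
    (∃ λ w → W w × w ≢ 0v × (∃ λ c → v ≡ c · w))

  HasSize : ∀ {k} → (Vec Carrier k → Set) → ℕ → Set
  HasSize P N = Σ (List (Vec Carrier _)) λ xs →
    Unique xs × (∀ v → (v ∈ xs) ⇔ (Normalized v × P v)) × length xs ≡ N

  InHyperplane : ∀ {k} → Vec Carrier k → Vec Carrier k → Set
  InHyperplane a v = dot a v ≡ 0#

  -- The subspaces U and W of the proposition, with m = n + 2,
  -- so F_q^{m-1} = F_q^{suc n} and V = F_q^{m+1} = F_q^{suc n + 2}.
  InU : ∀ {n} → (Vec Carrier (suc n) → Carrier) → Vec Carrier (suc n ℕ.+ 2) → Set
  InU f v = ∃ λ x → ∃ λ y → InPrimeField y × v ≡ x ++ (f x ∷ y ∷ [])

  InW : ∀ {n} → Vec Carrier (suc n ℕ.+ 2) → Set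
  InW {n} v = ∃ λ (x : Vec Carrier (suc n)) → ∃ λ y → InPrimeField y × v ≡ x ++ (y ∷ 0# ∷ [])

module Submission where

-- For 𝔽ₚ-additive f, counting the pairs (α, x) with α·x = f x shows that some f − α· is not surjective:
-- f x ≠ α·x + γ for all x. The hyperplane α·x − z + γ t = 0 then avoids L_U ∖ L_W, whose points are
-- the ⟨(x, f x, 1)⟩; and a point ⟨(x, z, 0)⟩ of L_W on it has z = α·x, so it lies in L_U, because
-- f − α·, not being injective on the line through x, vanishes at some nonzero multiple d x.
-- For (2), x ↦ ⟨(x, f x, 1)⟩ is a bijection onto L_U ∖ L_W, so |L_U ∖ L_W| = q^(m−1), while L_W is the
-- hyperplane t = 0 of PG(m, q), with (q^m − 1)/(q − 1) points; as (p − 1) ∣ (q − 1), the stated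
-- equivalence is then an identity between natural numbers.

open import Defs

module Counting where

  open import Data.Nat using (ℕ; zero; suc; _+_; _*_; _≤_; _<_; z≤n; s≤s)
  open import Data.Nat.Properties
  open import Algebra.Properties.CommutativeSemigroup +-commutativeSemigroup using (interchange)
  open import Data.Nat.ListAction using (sum)
  open import Data.Nat.ListAction.Properties using (sum-↭)
  open import Data.Fin as Fin using (Fin)
  import Data.Fin.Properties as Fin
  open import Data.List using (List; []; _∷_; _++_; map; length; lookup; cartesianProductWith)
  open import Data.List.Properties using (length-++; length-map; map-∘)
  open import Data.List.Membership.Propositional using (_∈_; _∉_; lose)
  open import Data.List.Membership.Propositional.Properties using (∈-map⁺; ∈-lookup)
  open import Data.List.Membership.Propositional.Properties.WithK using (unique∧set⇒bag)
  open import Data.List.Relation.Unary.All as All using ()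
  open import Data.List.Relation.Unary.All.Properties using (All¬⇒¬Any)
  open import Data.List.Relation.Unary.Any as Any using (here; there)
  open import Data.List.Relation.Unary.AllPairs using (_∷_)
  open import Data.List.Relation.Unary.Unique.Propositional using (Unique)
  import Data.List.Relation.Unary.Unique.Propositional.Properties as Unique
  open import Data.List.Relation.Binary.BagAndSetEquality using (∼bag⇒↭)
  open import Data.List.Relation.Binary.Permutation.Propositional using (_↭_)
  import Data.List.Relation.Binary.Permutation.Propositional.Properties as ↭
  open import Data.Product using (∃; ∃₂; _×_; _,_)
  open import Data.Empty using (⊥-elim)
  open import Function using (_∘_; id)
  open import Function.Bundles using (_⇔_; mk⇔)
  open import Relation.Binary.Definitions using (DecidableEquality)
  open import Relation.Binary.PropositionalEquality
  open import Relation.Nullary using (Dec; yes; no)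
  open import Relation.Nullary.Decidable using (map′)

  private variable
    A B C : Set

  same-members⇒↭ : {xs ys : List A} → Unique xs → Unique ys → (∀ x → x ∈ xs ⇔ x ∈ ys) → xs ↭ ys
  same-members⇒↭ uxs uys mem = ∼bag⇒↭ (unique∧set⇒bag uxs uys (λ {x} → mem x))

  length-cartesianProductWith : (f : A → B → C) (xs : List A) (ys : List B) →
    length (cartesianProductWith f xs ys) ≡ length xs * length ys
  length-cartesianProductWith f [] ys = refl
  length-cartesianProductWith f (x ∷ xs) ys = trans (length-++ (map (f x) ys))
    (cong₂ _+_ (length-map (f x) ys) (length-cartesianProductWith f xs ys))

  lookup-injective : {xs : List A} → Unique xs → ∀ {i j} → lookup xs i ≡ lookup xs j → i ≡ j
  lookup-injective {xs = x ∷ xs} _ {Fin.zero} {Fin.zero} _ = refl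
  lookup-injective {xs = x ∷ xs} (x∉xs ∷ _) {Fin.zero} {Fin.suc j} eq = ⊥-elim (All.lookup x∉xs (∈-lookup j) eq)
  lookup-injective {xs = x ∷ xs} (x∉xs ∷ _) {Fin.suc i} {Fin.zero} eq = ⊥-elim (All.lookup x∉xs (∈-lookup i) (sym eq))
  lookup-injective {xs = x ∷ xs} (_ ∷ uxs) {Fin.suc i} {Fin.suc j} eq = cong Fin.suc (lookup-injective uxs eq)

  ∃? : {xs : List A} → (∀ x → x ∈ xs) → {P : A → Set} → (∀ x → Dec (P x)) → Dec (∃ P)
  ∃? {xs = xs} complete P? = map′ Any.satisfied (λ (x , px) → lose (complete x) px) (Any.any? P? xs)

  -- A value t that is missed lets h be punched down into Fin (m − 1), so the pigeonhole principle applies.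
  non-surjective⇒non-injective : ∀ {m} (h : Fin m → Fin m) {t} → (∀ i → h i ≢ t) →
    ∃₂ λ i j → i ≢ j × h i ≡ h j
  non-surjective⇒non-injective {suc m} h {t} h≢t
    with i , j , i<j , eq ← Fin.pigeonhole (n<1+n m) (λ i → Fin.punchOut (h≢t i ∘ sym))
    = i , j , Fin.<⇒≢ i<j , Fin.punchOut-injective (h≢t i ∘ sym) (h≢t j ∘ sym) eq

  distinct⇒2≤ : ∀ {m} (i j : Fin m) → i ≢ j → 2 ≤ m
  distinct⇒2≤ {suc zero} Fin.zero Fin.zero i≢j = ⊥-elim (i≢j refl)
  distinct⇒2≤ {suc (suc m)} _ _ _ = s≤s (s≤s z≤n)

  ∑ : List A → (A → ℕ) → ℕ
  ∑ xs f = sum (map f xs)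

  syntax ∑ xs (λ x → e) = ∑[ x ∈ xs ] e

  𝟙 : {P : Set} → Dec P → ℕ
  𝟙 (yes _) = 1
  𝟙 (no _) = 0

  𝟙-cong : {P Q : Set} (p : Dec P) (q : Dec Q) → (P → Q) → (Q → P) → 𝟙 p ≡ 𝟙 q
  𝟙-cong (yes _) (yes _) _ _ = refl
  𝟙-cong (yes p) (no ¬q) f _ = ⊥-elim (¬q (f p))
  𝟙-cong (no ¬p) (yes q) _ g = ⊥-elim (¬p (g q))
  𝟙-cong (no _) (no _) _ _ = refl

  𝟙-yes : {P : Set} (p : Dec P) → P → 𝟙 p ≡ 1
  𝟙-yes (yes _) _ = refl
  𝟙-yes (no ¬p) p = ⊥-elim (¬p p)

  ∑-cong : (xs : List A) {f g : A → ℕ} → (∀ x → f x ≡ g x) → ∑ xs f ≡ ∑ xs g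
  ∑-cong [] eq = refl
  ∑-cong (x ∷ xs) eq = cong₂ _+_ (eq x) (∑-cong xs eq)

  ∑-const : (xs : List A) (c : ℕ) → ∑[ x ∈ xs ] c ≡ length xs * c
  ∑-const [] c = refl
  ∑-const (x ∷ xs) c = cong (c +_) (∑-const xs c)

  ∑-distrib-+ : (xs : List A) (f g : A → ℕ) → ∑[ x ∈ xs ] (f x + g x) ≡ ∑ xs f + ∑ xs g
  ∑-distrib-+ [] f g = refl
  ∑-distrib-+ (x ∷ xs) f g =
    trans (cong (f x + g x +_) (∑-distrib-+ xs f g)) (interchange (f x) (g x) (∑ xs f) (∑ xs g))

  ∑-comm : (xs : List A) (ys : List B) (F : A → B → ℕ) →
    ∑[ x ∈ xs ] ∑[ y ∈ ys ] F x y ≡ ∑[ y ∈ ys ] ∑[ x ∈ xs ] F x y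
  ∑-comm [] ys F = trans (sym (*-zeroʳ (length ys))) (sym (∑-const ys 0))
  ∑-comm (x ∷ xs) ys F = trans (cong (∑ ys (F x) +_) (∑-comm xs ys F))
    (sym (∑-distrib-+ ys (F x) (λ y → ∑[ x ∈ xs ] F x y)))

  ∑-map : (g : A → B) (xs : List A) (f : B → ℕ) → ∑ (map g xs) f ≡ ∑[ x ∈ xs ] f (g x)
  ∑-map g xs f = cong sum (sym (map-∘ xs))

  ∑-↭ : {xs ys : List A} (f : A → ℕ) → xs ↭ ys → ∑ xs f ≡ ∑ ys f
  ∑-↭ f p = sum-↭ (↭.map⁺ f p)

  ∑-bijection : {xs : List A} → Unique xs → (∀ x → x ∈ xs) →
    (π π⁻¹ : A → A) → (∀ x → π (π⁻¹ x) ≡ x) → (∀ x → π⁻¹ (π x) ≡ x) →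
    (f : A → ℕ) → ∑[ x ∈ xs ] f (π x) ≡ ∑ xs f
  ∑-bijection {xs = xs} uxs complete π π⁻¹ ππ⁻¹ π⁻¹π f =
    trans (sym (∑-map π xs f)) (∑-↭ f (same-members⇒↭ (Unique.map⁺ π-injective uxs) uxs members))
    where
    π-injective : ∀ {x y} → π x ≡ π y → x ≡ y
    π-injective {x} {y} eq = trans (sym (π⁻¹π x)) (trans (cong π⁻¹ eq) (π⁻¹π y))
    members : ∀ x → x ∈ map π xs ⇔ x ∈ xs
    members x = mk⇔ (λ _ → complete x) (λ _ → subst (_∈ map π xs) (ππ⁻¹ x) (∈-map⁺ π (complete (π⁻¹ x))))

  ∑-𝟙-≡ : (_≟_ : DecidableEquality A) {c : A} (xs : List A) → Unique xs → c ∈ xs → ∑[ x ∈ xs ] 𝟙 (c ≟ x) ≡ 1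
  ∑-𝟙-≡ _≟_ {c} (x ∷ xs) (x∉xs ∷ uxs) c∈ with c ≟ x | c∈
  ... | yes refl | _ =
    cong suc (trans (∑-cong xs (λ y → 𝟙-cong (c ≟ y) (x ≟ y) id id)) (∑-𝟙-∉ xs (All¬⇒¬Any x∉xs)))
    where
    ∑-𝟙-∉ : ∀ ys → x ∉ ys → ∑[ y ∈ ys ] 𝟙 (x ≟ y) ≡ 0
    ∑-𝟙-∉ [] _ = refl
    ∑-𝟙-∉ (y ∷ ys) x∉ with x ≟ y
    ... | yes x≡y = ⊥-elim (x∉ (here x≡y))
    ... | no _ = ∑-𝟙-∉ ys (x∉ ∘ there)
  ... | no c≢x | here c≡x = ⊥-elim (c≢x c≡x)
  ... | no _ | there c∈xs = ∑-𝟙-≡ _≟_ xs uxs c∈xs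

  ∑-mono-≤ : (xs : List A) {f g : A → ℕ} → (∀ x → f x ≤ g x) → ∑ xs f ≤ ∑ xs g
  ∑-mono-≤ [] f≤g = z≤n
  ∑-mono-≤ (x ∷ xs) f≤g = +-mono-≤ (f≤g x) (∑-mono-≤ xs f≤g)

  ∑-mono-< : (xs : List A) {f g : A → ℕ} {c : A} → (∀ x → f x ≤ g x) → c ∈ xs → f c < g c → ∑ xs f < ∑ xs g
  ∑-mono-< (x ∷ xs) f≤g (here refl) fc<gc = +-mono-<-≤ fc<gc (∑-mono-≤ xs f≤g)
  ∑-mono-< (x ∷ xs) f≤g (there c∈xs) fc<gc = +-mono-≤-< (f≤g x) (∑-mono-< xs f≤g c∈xs fc<gc)

module NatArithmetic where

  open import Data.Nat
  open import Data.Nat.Properties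
  open import Data.Nat.DivMod using (m*n/n≡m)
  open import Data.Nat.Tactic.RingSolver using (solve-∀)
  open import Data.Product using (∃; _,_)
  open import Function.Bundles using (_⇔_; mk⇔)
  open import Function.Construct.Composition using (_⇔-∘_)
  open import Relation.Binary.PropositionalEquality

  [1+m]^n≡1+m*k : ∀ m n → ∃ λ k → suc m ^ n ≡ suc (m * k)
  [1+m]^n≡1+m*k m zero = 0 , cong suc (sym (*-zeroʳ m))
  [1+m]^n≡1+m*k m (suc n) with k , eq ← [1+m]^n≡1+m*k m n =
    k + suc (m * k) , trans (cong (suc m *_) eq) (expand m k)
    where
    expand : ∀ m k → suc m * suc (m * k) ≡ suc (m * (k + suc (m * k)))
    expand = solve-∀

  geometric-sum : ∀ {q Q} → q ≡ suc Q → (N : ℕ → ℕ) → N 0 ≡ 0 → (∀ k → N (suc k) ≡ q ^ k + N k) →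
    ∀ k → N k * Q + 1 ≡ q ^ k
  geometric-sum refl N N0≡0 N-suc zero = cong (λ t → t * _ + 1) N0≡0
  geometric-sum {Q = Q} refl N N0≡0 N-suc (suc k) = begin
    N (suc k) * Q + 1             ≡⟨ cong (λ t → t * Q + 1) (N-suc k) ⟩
    (suc Q ^ k + N k) * Q + 1     ≡⟨ regroup (suc Q ^ k) (N k) Q ⟩
    suc Q ^ k * Q + (N k * Q + 1) ≡⟨ cong (suc Q ^ k * Q +_) (geometric-sum refl N N0≡0 N-suc k) ⟩
    suc Q ^ k * Q + suc Q ^ k     ≡⟨ factor (suc Q ^ k) Q ⟩
    suc Q ^ suc k                 ∎
    where
    open ≡-Reasoning
    regroup : ∀ X N Q → (X + N) * Q + 1 ≡ X * Q + (N * Q + 1)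
    regroup = solve-∀
    factor : ∀ X Q → X * Q + X ≡ suc Q * X
    factor = solve-∀

  geometric-step : ∀ {q Q X N} → q ≡ suc Q → N * Q + 1 ≡ X → (X + N) * q + 1 ≡ q * X + X + N
  geometric-step {Q = Q} {X} {N} refl NQ+1≡X = trans (expand X N Q) (cong (λ t → suc Q * X + t + N) NQ+1≡X)
    where
    expand : ∀ X N Q → (X + N) * suc Q + 1 ≡ suc Q * X + (N * Q + 1) + N
    expand = solve-∀

  *-div : ∀ m d .{{_ : NonZero d}} → (m * d) div d ≡ m
  *-div m (suc d) = m*n/n≡m m (suc d)

  [1+PR]X+bP≡PY+X⇔RX+b≡Y : ∀ {P R X b Y} .{{_ : NonZero P}} →
    (suc (P * R) * X * 1 + b * P ≡ P * Y + X) ⇔ (R * X + b ≡ Y)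
  [1+PR]X+bP≡PY+X⇔RX+b≡Y {P} {R} {X} {b} {Y} = mk⇔
    (λ eq → *-cancelˡ-≡ _ _ P (+-cancelˡ-≡ X _ _ (trans (sym (expand P R X b)) (trans eq (+-comm (P * Y) X)))))
    (λ { refl → trans (expand P R X b) (+-comm X _) })
    where
    expand : ∀ P R X b → suc (P * R) * X * 1 + b * P ≡ X + P * (R * X + b)
    expand = solve-∀

  c+b≡Y+N⇒[m+b≡Y⇔c≡m+N] : ∀ {m b c Y N} → c + b ≡ Y + N → (m + b ≡ Y) ⇔ (c ≡ m + N)
  c+b≡Y+N⇒[m+b≡Y⇔c≡m+N] {m} {b} {c} {Y} {N} c+b≡Y+N = mk⇔
    (λ m+b≡Y → +-cancelʳ-≡ b c (m + N) (trans c+b≡Y+N (trans (cong (_+ N) (sym m+b≡Y)) (exchange m b N))))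
    (λ { refl → +-cancelʳ-≡ N _ _ (trans (exchange m b N) c+b≡Y+N) })
    where
    exchange : ∀ m b N → m + b + N ≡ m + N + b
    exchange = solve-∀

  -- With q = 1 + P R and p = 1 + P, both sides say that R q^n + b = q^(n+1) + q^n.
  size-equivalence : ∀ {p q n N a b c} P R .{{_ : NonZero P}} → 1 < q → p ≡ suc P → q ≡ suc (P * R) →
    a ≡ q ^ suc n → c + b ≡ q ^ suc n + q ^ n + N → N * (q ∸ 1) + 1 ≡ q ^ n →
    (a * 1 + b * (p ∸ 1) ≡ (p ∸ 1) * (q ^ suc n + q ^ n) + q ^ n)
      ⇔ (c ≡ (q ^ n * (q ∸ 1)) div (p ∸ 1) + (q ^ n ∸ 1) div (q ∸ 1))
  size-equivalence {q = q} {n} {N} {b = b} {c} P R 1<q refl refl refl c+b≡ NQ+1≡X =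
    subst (λ t → (q ^ suc n * 1 + b * P ≡ P * (q ^ suc n + X) + X) ⇔ (c ≡ t)) (sym quotients)
      (c+b≡Y+N⇒[m+b≡Y⇔c≡m+N] c+b≡ ⇔-∘ [1+PR]X+bP≡PY+X⇔RX+b≡Y)
    where
    X = q ^ n
    instance
      Q-nonZero : NonZero (P * R)
      Q-nonZero = >-nonZero (≤-pred 1<q)
    quotients : (X * (P * R)) div P + (X ∸ 1) div (P * R) ≡ R * X + N
    quotients = cong₂ _+_
      (trans (cong (_div P) (swap X P R)) (*-div (R * X) P))
      (trans (cong (λ t → (t ∸ 1) div (P * R)) (sym NQ+1≡X)) (trans (cong (_div (P * R)) (m+n∸n≡m _ 1)) (*-div N (P * R))))
      where
      swap : ∀ X P R → X * (P * R) ≡ R * X * P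
      swap = solve-∀

module Geometry (F : FiniteField) where

  open import Data.Nat as ℕ using (ℕ; zero; suc; z≤n; s≤s)
  import Data.Nat.Properties as ℕ
  open import Data.Fin as Fin using (Fin; toℕ)
  import Data.Fin.Properties as Fin
  open import Data.Product using (∃; ∃₂; _×_; _,_; proj₁; proj₂)
  open import Data.Sum using (_⊎_; inj₁; inj₂)
  open import Data.Empty using (⊥; ⊥-elim)
  open import Data.List as List using (List; []; _∷_; _++_; length; cartesianProductWith)
  import Data.List.Properties as List
  open import Data.List.Membership.Propositional using (_∈_)
  open import Data.List.Membership.Propositional.Properties
    using (∈-cartesianProductWith⁺; ∈-cartesianProductWith⁻; ∈-map⁺; ∈-map⁻; ∈-++⁺ˡ; ∈-++⁺ʳ; ∈-++⁻)
  import Data.List.Membership.DecPropositional as DecMembership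
  open import Data.List.Relation.Unary.All using ([])
  open import Data.List.Relation.Unary.AllPairs using ([]; _∷_)
  open import Data.List.Relation.Unary.Any as Any using (here)
  import Data.List.Relation.Unary.Any.Properties as Any
  open import Data.List.Relation.Unary.Unique.Propositional using (Unique)
  import Data.List.Relation.Unary.Unique.Propositional.Properties as Unique
  open import Data.List.Relation.Binary.Permutation.Propositional.Properties using (↭-length)
  open import Data.Vec as Vec using (Vec; []; _∷_)
  import Data.Vec.Properties as Vec
  open import Algebra.Bundles using (CommutativeRing)
  open import Function using (_∘_)
  open import Function.Bundles using (_⇔_; mk⇔; Equivalence)
  open import Relation.Binary.Definitions using (DecidableEquality)
  open import Relation.Binary.PropositionalEquality
  open import Relation.Nullary using (¬_; yes; no; ¬?)
  open import Relation.Nullary.Decidable using (decidable-stable)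
  open Counting
  open NatArithmetic

  open FiniteField F hiding (_+_; _*_; -_; 0#; 1#)

  commutativeRing : CommutativeRing _ _
  commutativeRing = record { isCommutativeRing = isCommutativeRing }

  open CommutativeRing commutativeRing
    using (_+_; _*_; -_; 0#; 1#; +-assoc; +-comm; +-identityˡ; +-identityʳ; -‿inverseˡ; -‿inverseʳ; *-assoc; *-comm;
           *-identityˡ; *-identityʳ; distribˡ; distribʳ; zeroˡ; zeroʳ; ring; semiring)
  open import Algebra.Properties.Ring ring
    using (+-identityˡ-unique; +-identityʳ-unique; x∙y⁻¹≈ε⇒x≈y; x≈y⇒x∙y⁻¹≈ε; -1*x≈-x; -‿+-comm)
  open import Algebra.Properties.CommutativeSemigroup (CommutativeRing.+-commutativeSemigroup commutativeRing)
    using (interchange)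
  open import Algebra.Properties.CommutativeSemigroup (CommutativeRing.*-commutativeSemigroup commutativeRing)
    using (x∙yz≈y∙xz)
  open import Algebra.Properties.Semiring.Exp semiring using (_^_; ^-homo-*)
  open import Algebra.Properties.Semiring.Mult semiring using (×1-homo-*) renaming (_×_ to _times_)
  open ≡-Reasoning

  q : ℕ
  q = order

  -- Division by zero returns the junk value 0#.
  infix 30 _⁻¹
  _⁻¹ : Carrier → Carrier
  a ⁻¹ with a ≟ 0#
  ... | yes _ = 0#
  ... | no a≢0 = proj₁ (inverse a a≢0)

  ⁻¹-inverseʳ : ∀ {a} → a ≢ 0# → a * a ⁻¹ ≡ 1#
  ⁻¹-inverseʳ {a} a≢0 with a ≟ 0#
  ... | yes a≡0 = ⊥-elim (a≢0 a≡0)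
  ... | no a≢0 = proj₂ (inverse a a≢0)

  ⁻¹-inverseˡ : ∀ {a} → a ≢ 0# → a ⁻¹ * a ≡ 1#
  ⁻¹-inverseˡ a≢0 = trans (*-comm _ _) (⁻¹-inverseʳ a≢0)

  1≢0 : 1# ≢ 0#
  1≢0 = 0≢1 ∘ sym

  *-cancelˡ : ∀ {a b c} → a ≢ 0# → a * b ≡ a * c → b ≡ c
  *-cancelˡ {a} {b} {c} a≢0 eq = begin
    b              ≡⟨ sym (*-identityˡ b) ⟩
    1# * b         ≡⟨ cong (_* b) (⁻¹-inverseˡ a≢0) ⟨
    a ⁻¹ * a * b   ≡⟨ *-assoc _ a b ⟩
    a ⁻¹ * (a * b) ≡⟨ cong (a ⁻¹ *_) eq ⟩
    a ⁻¹ * (a * c) ≡⟨ *-assoc _ a c ⟨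
    a ⁻¹ * a * c   ≡⟨ cong (_* c) (⁻¹-inverseˡ a≢0) ⟩
    1# * c         ≡⟨ *-identityˡ c ⟩
    c              ∎

  *-≢0 : ∀ {a b} → a ≢ 0# → b ≢ 0# → a * b ≢ 0#
  *-≢0 a≢0 b≢0 ab≡0 = b≢0 (*-cancelˡ a≢0 (trans ab≡0 (sym (zeroʳ _))))

  ⁻¹-≢0 : ∀ {a} → a ≢ 0# → a ⁻¹ ≢ 0#
  ⁻¹-≢0 a≢0 a⁻¹≡0 = 1≢0 (trans (sym (⁻¹-inverseʳ a≢0)) (trans (cong (_ *_) a⁻¹≡0) (zeroʳ _)))

  x+y-x≡y : ∀ x y → x + y + - x ≡ y
  x+y-x≡y x y = begin
    x + y + - x    ≡⟨ cong (_+ - x) (+-comm x y) ⟩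
    y + x + - x    ≡⟨ +-assoc y x (- x) ⟩
    y + (x + - x)  ≡⟨ cong (y +_) (-‿inverseʳ x) ⟩
    y + 0#         ≡⟨ +-identityʳ y ⟩
    y              ∎

  x-y+y≡x : ∀ x y → x + - y + y ≡ x
  x-y+y≡x x y = trans (+-assoc x (- y) y) (trans (cong (x +_) (-‿inverseˡ y)) (+-identityʳ x))

  index : Carrier → Fin q
  index a = Any.index (complete a)

  index-injective : ∀ {a b} → index a ≡ index b → a ≡ b
  index-injective {a} {b} eq = trans (Any.lookup-index (complete a))
    (trans (cong (List.lookup elements) eq) (sym (Any.lookup-index (complete b))))

  1<q : 1 ℕ.< q
  1<q = distinct⇒2≤ (index 0#) (index 1#) (0≢1 ∘ index-injective)

  instance
    q-nonZero : ℕ.NonZero q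
    q-nonZero = ℕ.>-nonZero (ℕ.<-≤-trans (s≤s z≤n) 1<q)

  q≡1+[q∸1] : q ≡ suc (q ℕ.∸ 1)
  q≡1+[q∸1] = sym (ℕ.m+[n∸m]≡n (ℕ.<⇒≤ 1<q))

  non-surjective⇒collision : (h : Carrier → Carrier) {c : Carrier} → (∀ a → h a ≢ c) →
    ∃₂ λ a b → a ≢ b × h a ≡ h b
  non-surjective⇒collision h h≢c
    with i , j , i≢j , eq ← non-surjective⇒non-injective (index ∘ h ∘ List.lookup elements)
                               (λ i → h≢c (List.lookup elements i) ∘ index-injective)
    = List.lookup elements i , List.lookup elements j , i≢j ∘ lookup-injective unique , index-injective eq

  ×1≡times : ∀ k → k ×1 ≡ k times 1#
  ×1≡times zero = refl
  ×1≡times (suc k) = cong (1# +_) (×1≡times k)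

  InPrimeField-* : ∀ {y z} → InPrimeField y → InPrimeField z → InPrimeField (y * z)
  InPrimeField-* (k , refl) (m , refl) = k ℕ.* m , (begin
    k ×1 * m ×1               ≡⟨ cong₂ _*_ (×1≡times k) (×1≡times m) ⟩
    k times 1# * m times 1#   ≡⟨ ×1-homo-* k m ⟨
    (k ℕ.* m) times 1#        ≡⟨ ×1≡times (k ℕ.* m) ⟨
    (k ℕ.* m) ×1              ∎)

  InPrimeField-^ : ∀ {y} → InPrimeField y → ∀ i → InPrimeField (y ^ i)
  InPrimeField-^ y∈ zero = 1 , sym (+-identityʳ 1#)
  InPrimeField-^ y∈ (suc i) = InPrimeField-* y∈ (InPrimeField-^ y∈ i)

  -- Some power y ^ i with 0 < i ≤ q equals 1, by pigeonhole on y ^ 0, …, y ^ q.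
  InPrimeField-inverse : ∀ {y} → InPrimeField y → y ≢ 0# → ∃ λ z → InPrimeField z × y * z ≡ 1#
  InPrimeField-inverse {y} y∈ y≢0
    with i , j , i<j , yⁱ≡yʲ ← Fin.pigeonhole (ℕ.n<1+n q) (index ∘ (y ^_) ∘ toℕ)
    with o , i+1+o≡j ← ℕ.m≤n⇒∃[o]m+o≡n i<j
    = y ^ o , InPrimeField-^ y∈ o , *-cancelˡ (^-≢0 (toℕ i)) (begin
      y ^ toℕ i * (y * y ^ o)   ≡⟨ ^-homo-* y (toℕ i) (suc o) ⟨
      y ^ (toℕ i ℕ.+ suc o)    ≡⟨ cong (y ^_) (trans (ℕ.+-suc (toℕ i) o) i+1+o≡j) ⟩
      y ^ toℕ j                ≡⟨ index-injective yⁱ≡yʲ ⟨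
      y ^ toℕ i                ≡⟨ *-identityʳ _ ⟨
      y ^ toℕ i * 1#           ∎)
    where
    ^-≢0 : ∀ k → y ^ k ≢ 0#
    ^-≢0 zero = 1≢0
    ^-≢0 (suc k) = *-≢0 y≢0 (^-≢0 k)

  ⊝_ : ∀ {k} → Vec Carrier k → Vec Carrier k
  ⊝_ = Vec.map -_

  ⊕-assoc : ∀ {k} (u v w : Vec Carrier k) → (u ⊕ v) ⊕ w ≡ u ⊕ (v ⊕ w)
  ⊕-assoc = Vec.zipWith-assoc +-assoc

  ⊕-identityʳ : ∀ {k} (v : Vec Carrier k) → v ⊕ 0v ≡ v
  ⊕-identityʳ = Vec.zipWith-identityʳ +-identityʳ

  ⊕-⊝-cancelʳ : ∀ {k} (u v : Vec Carrier k) → (u ⊕ v) ⊕ (⊝ v) ≡ u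
  ⊕-⊝-cancelʳ u v = trans (⊕-assoc u v (⊝ v)) (trans (cong (u ⊕_) (Vec.zipWith-inverseʳ -‿inverseʳ v)) (⊕-identityʳ u))

  ⊝-⊕-cancelʳ : ∀ {k} (u v : Vec Carrier k) → (u ⊕ (⊝ v)) ⊕ v ≡ u
  ⊝-⊕-cancelʳ u v = trans (⊕-assoc u (⊝ v) v) (trans (cong (u ⊕_) (Vec.zipWith-inverseˡ -‿inverseˡ v)) (⊕-identityʳ u))

  ·-++ : ∀ {k j} c (u : Vec Carrier k) (v : Vec Carrier j) → c · (u Vec.++ v) ≡ (c · u) Vec.++ (c · v)
  ·-++ c = Vec.map-++ (c *_)

  ·-assoc : ∀ {k} c d (v : Vec Carrier k) → c · (d · v) ≡ (c * d) · v
  ·-assoc c d v = trans (sym (Vec.map-∘ (c *_) (d *_) v)) (Vec.map-cong (λ x → sym (*-assoc c d x)) v)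

  ·-identityˡ : ∀ {k} (v : Vec Carrier k) → 1# · v ≡ v
  ·-identityˡ v = trans (Vec.map-cong *-identityˡ v) (Vec.map-id v)

  ·-inverse : ∀ {k c d} → c * d ≡ 1# → (v : Vec Carrier k) → c · (d · v) ≡ v
  ·-inverse {c = c} {d} cd≡1 v = trans (·-assoc c d v) (trans (cong (_· v) cd≡1) (·-identityˡ v))

  ·-cancelˡ : ∀ {k c} {u v : Vec Carrier k} → c ≢ 0# → c · u ≡ c · v → u ≡ v
  ·-cancelˡ {c = c} {u} {v} c≢0 eq =
    trans (sym (·-inverse (⁻¹-inverseˡ c≢0) u)) (trans (cong (c ⁻¹ ·_) eq) (·-inverse (⁻¹-inverseˡ c≢0) v))

  ·-zeroˡ : ∀ {k} (v : Vec Carrier k) → 0# · v ≡ 0v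
  ·-zeroˡ v = trans (Vec.map-cong zeroˡ v) (Vec.map-const v 0#)

  ·-zeroʳ : ∀ {k} c → c · 0v {k} ≡ 0v
  ·-zeroʳ {k} c = trans (Vec.map-replicate (c *_) 0# k) (cong (Vec.replicate k) (zeroʳ c))

  ·-distribʳ : ∀ {k} c d (v : Vec Carrier k) → (c + d) · v ≡ (c · v) ⊕ (d · v)
  ·-distribʳ c d [] = refl
  ·-distribʳ c d (a ∷ v) = cong₂ _∷_ (distribʳ a c d) (·-distribʳ c d v)

  0v-++ : ∀ {k j} → 0v {k ℕ.+ j} ≡ 0v {k} Vec.++ 0v {j}
  0v-++ {zero} = refl
  0v-++ {suc k} = cong (0# ∷_) (0v-++ {k})

  _≟ⱽ_ : ∀ {k} → DecidableEquality (Vec Carrier k)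
  _≟ⱽ_ = Vec.≡-dec _≟_

  dot-comm : ∀ {k} (u v : Vec Carrier k) → dot u v ≡ dot v u
  dot-comm [] [] = refl
  dot-comm (a ∷ u) (b ∷ v) = cong₂ _+_ (*-comm a b) (dot-comm u v)

  dot-++ : ∀ {k j} (u u′ : Vec Carrier k) (v v′ : Vec Carrier j) →
    dot (u Vec.++ v) (u′ Vec.++ v′) ≡ dot u u′ + dot v v′
  dot-++ [] [] v v′ = sym (+-identityˡ _)
  dot-++ (a ∷ u) (b ∷ u′) v v′ = trans (cong (a * b +_) (dot-++ u u′ v v′)) (sym (+-assoc _ _ _))

  dot-·ʳ : ∀ {k} (u : Vec Carrier k) c v → dot u (c · v) ≡ c * dot u v
  dot-·ʳ [] c [] = sym (zeroʳ c)
  dot-·ʳ (a ∷ u) c (b ∷ v) = begin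
    a * (c * b) + dot u (c · v) ≡⟨ cong₂ _+_ (x∙yz≈y∙xz a c b) (dot-·ʳ u c v) ⟩
    c * (a * b) + c * dot u v   ≡⟨ distribˡ c _ _ ⟨
    c * (a * b + dot u v)       ∎

  dot-⊕ʳ : ∀ {k} (u v w : Vec Carrier k) → dot u (v ⊕ w) ≡ dot u v + dot u w
  dot-⊕ʳ [] [] [] = sym (+-identityʳ 0#)
  dot-⊕ʳ (a ∷ u) (b ∷ v) (c ∷ w) = begin
    a * (b + c) + dot u (v ⊕ w)                 ≡⟨ cong₂ _+_ (distribˡ a b c) (dot-⊕ʳ u v w) ⟩
    (a * b + a * c) + (dot u v + dot u w)       ≡⟨ interchange (a * b) (a * c) _ _ ⟩
    (a * b + dot u v) + (a * c + dot u w)       ∎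

  dot-⊕ˡ : ∀ {k} (u v w : Vec Carrier k) → dot (u ⊕ v) w ≡ dot u w + dot v w
  dot-⊕ˡ u v w = trans (dot-comm (u ⊕ v) w) (trans (dot-⊕ʳ w u v) (cong₂ _+_ (dot-comm w u) (dot-comm w v)))

  dot-0ʳ : ∀ {k} (u : Vec Carrier k) → dot u 0v ≡ 0#
  dot-0ʳ u = trans (cong (dot u) (sym (·-zeroˡ u))) (trans (dot-·ʳ u 0# u) (zeroˡ _))

  dot-surjective : ∀ {k} {x : Vec Carrier k} → x ≢ 0v → ∀ c → ∃ λ α → dot α x ≡ c
  dot-surjective {x = []} x≢0 c = ⊥-elim (x≢0 refl)
  dot-surjective {x = a ∷ x} x≢0 c with a ≟ 0#
  ... | no a≢0 = c * a ⁻¹ ∷ 0v , (begin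
    c * a ⁻¹ * a + dot 0v x  ≡⟨ cong₂ _+_ (*-assoc c _ a) (trans (dot-comm 0v x) (dot-0ʳ x)) ⟩
    c * (a ⁻¹ * a) + 0#      ≡⟨ cong (λ t → c * t + 0#) (⁻¹-inverseˡ a≢0) ⟩
    c * 1# + 0#              ≡⟨ trans (+-identityʳ _) (*-identityʳ c) ⟩
    c                        ∎)
  ... | yes refl with α , dotαx≡c ← dot-surjective (x≢0 ∘ cong (0# ∷_)) c
    = 0# ∷ α , trans (cong (_+ dot α x) (zeroʳ 0#)) (trans (+-identityˡ _) dotαx≡c)

  vectors : ∀ k → List (Vec Carrier k)
  vectors zero = [] ∷ []
  vectors (suc k) = cartesianProductWith _∷_ elements (vectors k)

  vectors-unique : ∀ k → Unique (vectors k)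
  vectors-unique zero = [] ∷ []
  vectors-unique (suc k) = Unique.cartesianProductWith⁺ _∷_ Vec.∷-injective unique (vectors-unique k)

  ∈-vectors : ∀ {k} (v : Vec Carrier k) → v ∈ vectors k
  ∈-vectors [] = here refl
  ∈-vectors (a ∷ v) = ∈-cartesianProductWith⁺ _∷_ (complete a) (∈-vectors v)

  length-vectors : ∀ k → length (vectors k) ≡ q ℕ.^ k
  length-vectors zero = refl
  length-vectors (suc k) = trans (length-cartesianProductWith _∷_ elements (vectors k)) (cong (q ℕ.*_) (length-vectors k))

  -- Points of projective space

  Normalized⇒≢0v : ∀ {k} {v : Vec Carrier k} → Normalized v → v ≢ 0v
  Normalized⇒≢0v {v = a ∷ v} (inj₁ a≡1) eq = 1≢0 (trans (sym a≡1) (Vec.∷-injectiveˡ eq))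
  Normalized⇒≢0v {v = a ∷ v} (inj₂ (_ , nv)) eq = Normalized⇒≢0v nv (Vec.∷-injectiveʳ eq)

  Normalized-++ : ∀ {k j} (u : Vec Carrier k) (v : Vec Carrier j) →
    Normalized (u Vec.++ v) ⇔ (Normalized u ⊎ (u ≡ 0v × Normalized v))
  Normalized-++ [] v = mk⇔ (λ nv → inj₂ (refl , nv)) λ { (inj₁ ()) ; (inj₂ (_ , nv)) → nv }
  Normalized-++ (a ∷ u) v = mk⇔ to from
    where
    open Equivalence (Normalized-++ u v) renaming (to to to′; from to from′)
    to : Normalized (a ∷ u Vec.++ v) → Normalized (a ∷ u) ⊎ (a ∷ u ≡ 0v × Normalized v)
    to (inj₁ a≡1) = inj₁ (inj₁ a≡1)
    to (inj₂ (a≡0 , nuv)) with to′ nuv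
    ... | inj₁ nu = inj₁ (inj₂ (a≡0 , nu))
    ... | inj₂ (u≡0 , nv) = inj₂ (cong₂ _∷_ a≡0 u≡0 , nv)
    from : Normalized (a ∷ u) ⊎ (a ∷ u ≡ 0v × Normalized v) → Normalized (a ∷ u Vec.++ v)
    from (inj₁ (inj₁ a≡1)) = inj₁ a≡1
    from (inj₁ (inj₂ (a≡0 , nu))) = inj₂ (a≡0 , from′ (inj₁ nu))
    from (inj₂ (au≡0 , nv)) = inj₂ (Vec.∷-injectiveˡ au≡0 , from′ (inj₂ (Vec.∷-injectiveʳ au≡0 , nv)))

  normalizer : ∀ {k} (w : Vec Carrier k) → w ≢ 0v → ∃ λ e → e ≢ 0# × Normalized (e · w)
  normalizer [] w≢0 = ⊥-elim (w≢0 refl)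
  normalizer (a ∷ w) w≢0 with a ≟ 0#
  ... | no a≢0 = a ⁻¹ , ⁻¹-≢0 a≢0 , inj₁ (⁻¹-inverseˡ a≢0)
  ... | yes refl with e , e≢0 , nw ← normalizer w (w≢0 ∘ cong (0# ∷_))
    = e , e≢0 , inj₂ (zeroʳ e , nw)

  normalized-proportional⇒≡ : ∀ {k} {u v : Vec Carrier k} {c} → Normalized u → Normalized v → u ≡ c · v → u ≡ v
  normalized-proportional⇒≡ {u = a ∷ u} {b ∷ v} {c} nu nv eq with Vec.∷-injective eq
  ... | a≡cb , u≡cv with nu | nv
  ... | inj₁ a≡1 | inj₁ refl = cong₂ _∷_ a≡1 (trans u≡cv (trans (cong (_· v) c≡1) (·-identityˡ v)))
    where
    c≡1 : c ≡ 1#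
    c≡1 = trans (sym (*-identityʳ c)) (trans (sym a≡cb) a≡1)
  ... | inj₂ (a≡0 , nu′) | inj₁ refl =
    ⊥-elim (Normalized⇒≢0v nu′ (trans u≡cv (trans (cong (_· v) c≡0) (·-zeroˡ v))))
    where
    c≡0 : c ≡ 0#
    c≡0 = trans (sym (*-identityʳ c)) (trans (sym a≡cb) a≡0)
  ... | inj₁ a≡1 | inj₂ (refl , _) = ⊥-elim (1≢0 (trans (sym a≡1) (trans a≡cb (zeroʳ c))))
  ... | inj₂ (a≡0 , nu′) | inj₂ (refl , nv′) = cong₂ _∷_ a≡0 (normalized-proportional⇒≡ nu′ nv′ u≡cv)

  points : ∀ k → List (Vec Carrier k)
  points zero = []
  points (suc k) = List.map (1# ∷_) (vectors k) ++ List.map (0# ∷_) (points k)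

  points-unique : ∀ k → Unique (points k)
  points-unique zero = []
  points-unique (suc k) = Unique.++⁺ (Unique.map⁺ Vec.∷-injectiveʳ (vectors-unique k))
    (Unique.map⁺ Vec.∷-injectiveʳ (points-unique k)) disjoint
    where
    disjoint : ∀ {v} → v ∈ List.map (1# ∷_) (vectors k) × v ∈ List.map (0# ∷_) (points k) → ⊥
    disjoint (∈ones , ∈zeros) with _ , _ , refl ← ∈-map⁻ (1# ∷_) ∈ones | _ , _ , eq ← ∈-map⁻ (0# ∷_) ∈zeros
      = 1≢0 (Vec.∷-injectiveˡ eq)

  ∈-points⇔Normalized : ∀ {k} (v : Vec Carrier k) → v ∈ points k ⇔ Normalized v
  ∈-points⇔Normalized [] = mk⇔ (λ ()) (λ ())
  ∈-points⇔Normalized {suc k} (a ∷ v) = mk⇔ to from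
    where
    to : a ∷ v ∈ points (suc k) → Normalized (a ∷ v)
    to ∈ps with ∈-++⁻ (List.map (1# ∷_) (vectors k)) ∈ps
    ... | inj₁ ∈ones with _ , _ , eq ← ∈-map⁻ (1# ∷_) ∈ones = inj₁ (Vec.∷-injectiveˡ eq)
    ... | inj₂ ∈zeros with _ , ∈pts , eq ← ∈-map⁻ (0# ∷_) ∈zeros
      = inj₂ (Vec.∷-injectiveˡ eq ,
              Equivalence.to (∈-points⇔Normalized v) (subst (_∈ points k) (sym (Vec.∷-injectiveʳ eq)) ∈pts))
    from : Normalized (a ∷ v) → a ∷ v ∈ points (suc k)
    from (inj₁ refl) = ∈-++⁺ˡ (∈-map⁺ (1# ∷_) (∈-vectors v))
    from (inj₂ (refl , nv)) = ∈-++⁺ʳ _ (∈-map⁺ (0# ∷_) (Equivalence.from (∈-points⇔Normalized v) nv))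

  length-points-suc : ∀ k → length (points (suc k)) ≡ q ℕ.^ k ℕ.+ length (points k)
  length-points-suc k = trans (List.length-++ (List.map (1# ∷_) (vectors k)))
    (cong₂ ℕ._+_ (trans (List.length-map _ (vectors k)) (length-vectors k)) (List.length-map _ (points k)))

  length-points : ∀ k → length (points k) ℕ.* (q ℕ.∸ 1) ℕ.+ 1 ≡ q ℕ.^ k
  length-points = geometric-sum q≡1+[q∸1] (length ∘ points) refl length-points-suc

  HasSize-unique : ∀ {k} {P : Vec Carrier k → Set} {a b} → HasSize P a → HasSize P b → a ≡ b
  HasSize-unique (xs , uxs , mxs , refl) (ys , uys , mys , refl) =
    ↭-length (same-members⇒↭ uxs uys λ v → mk⇔ (from (mys v) ∘ to (mxs v)) (from (mxs v) ∘ to (mys v)))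
    where open Equivalence

  HasSize-split : ∀ {k} {P Q : Vec Carrier k → Set} {b c} →
    HasSize (λ v → Q v × P v) c → HasSize (λ v → P v × ¬ Q v) b → HasSize P (c ℕ.+ b)
  HasSize-split {P = P} {Q} (cs , ucs , mcs , refl) (bs , ubs , mbs , refl) =
    cs ++ bs , Unique.++⁺ ucs ubs disjoint , members , List.length-++ cs
    where
    open Equivalence
    disjoint : ∀ {v} → v ∈ cs × v ∈ bs → ⊥
    disjoint {v} (∈cs , ∈bs) = proj₂ (proj₂ (to (mbs v) ∈bs)) (proj₁ (proj₂ (to (mcs v) ∈cs)))
    members : ∀ v → v ∈ cs ++ bs ⇔ (Normalized v × P v)
    members v = mk⇔ to′ from′
      where
      to′ : v ∈ cs ++ bs → Normalized v × P v
      to′ ∈cs++bs with ∈-++⁻ cs ∈cs++bs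
      ... | inj₁ ∈cs with nv , _ , pv ← to (mcs v) ∈cs = nv , pv
      ... | inj₂ ∈bs with nv , pv , _ ← to (mbs v) ∈bs = nv , pv
      from′ : Normalized v × P v → v ∈ cs ++ bs
      from′ (nv , pv) with DecMembership._∈?_ _≟ⱽ_ v cs
      ... | yes ∈cs = ∈-++⁺ˡ ∈cs
      ... | no ∉cs = ∈-++⁺ʳ cs (from (mbs v) (nv , pv , λ qv → ∉cs (from (mcs v) (nv , qv , pv))))

  -- Fibres of additive maps

  Additive : ∀ {k} → (Vec Carrier k → Carrier) → Set
  Additive g = ∀ u v → g (u ⊕ v) ≡ g u + g v

  #fibre : ∀ {k} → (Vec Carrier k → Carrier) → Carrier → ℕ
  #fibre {k} g c = ∑[ x ∈ vectors k ] 𝟙 (g x ≟ c)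

  ∑-#fibre : ∀ {k} (g : Vec Carrier k → Carrier) → ∑[ c ∈ elements ] #fibre g c ≡ q ℕ.^ k
  ∑-#fibre {k} g = begin
    ∑[ c ∈ elements ] ∑[ x ∈ vectors k ] 𝟙 (g x ≟ c) ≡⟨ ∑-comm elements (vectors k) _ ⟩
    ∑[ x ∈ vectors k ] ∑[ c ∈ elements ] 𝟙 (g x ≟ c)
      ≡⟨ ∑-cong (vectors k) (λ x → ∑-𝟙-≡ _≟_ elements unique (complete (g x))) ⟩
    ∑[ x ∈ vectors k ] 1                              ≡⟨ ∑-const (vectors k) 1 ⟩
    length (vectors k) ℕ.* 1                          ≡⟨ ℕ.*-identityʳ _ ⟩
    length (vectors k)                                ≡⟨ length-vectors k ⟩
    q ℕ.^ k                                           ∎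

  #fibre-translate : ∀ {k} {g : Vec Carrier k → Carrier} {s c} → Additive g → g s ≡ c → #fibre g c ≡ #fibre g 0#
  #fibre-translate {k} {g} {s} {c} additive gs≡c = begin
    ∑[ x ∈ vectors k ] 𝟙 (g x ≟ c)
      ≡⟨ ∑-bijection (vectors-unique k) ∈-vectors (_⊕ s) (_⊕ (⊝ s))
           (λ x → ⊝-⊕-cancelʳ x s) (λ x → ⊕-⊝-cancelʳ x s) _ ⟨
    ∑[ x ∈ vectors k ] 𝟙 (g (x ⊕ s) ≟ c)
      ≡⟨ ∑-cong (vectors k) (λ x → 𝟙-cong (g (x ⊕ s) ≟ c) (g x ≟ 0#) (to x) (from x)) ⟩
    ∑[ x ∈ vectors k ] 𝟙 (g x ≟ 0#) ∎
    where
    g[x⊕s]≡gx+c : ∀ x → g (x ⊕ s) ≡ g x + c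
    g[x⊕s]≡gx+c x = trans (additive x s) (cong (g x +_) gs≡c)
    to : ∀ x → g (x ⊕ s) ≡ c → g x ≡ 0#
    to x eq = +-identityˡ-unique (g x) c (trans (sym (g[x⊕s]≡gx+c x)) eq)
    from : ∀ x → g x ≡ 0# → g (x ⊕ s) ≡ c
    from x eq = trans (g[x⊕s]≡gx+c x) (trans (cong (_+ c) eq) (+-identityˡ c))

  #fibre-surjective : ∀ {k} {g : Vec Carrier (suc k) → Carrier} → Additive g → (∀ c → ∃ λ s → g s ≡ c) →
    ∀ c → #fibre g c ≡ q ℕ.^ k
  #fibre-surjective {k} {g} additive surjective c = ℕ.*-cancelˡ-≡ _ _ q (begin
    q ℕ.* #fibre g c                   ≡⟨ cong (q ℕ.*_) (translate c) ⟩
    q ℕ.* #fibre g 0#                  ≡⟨ ∑-const elements (#fibre g 0#) ⟨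
    ∑[ c′ ∈ elements ] #fibre g 0#     ≡⟨ ∑-cong elements (sym ∘ translate) ⟩
    ∑[ c′ ∈ elements ] #fibre g c′     ≡⟨ ∑-#fibre g ⟩
    q ℕ.* q ℕ.^ k                      ∎)
    where
    translate : ∀ c → #fibre g c ≡ #fibre g 0#
    translate c = #fibre-translate additive (proj₂ (surjective c))

  -- On the line through x, h d = G (d · x) misses γ, so it is not injective; subtracting two
  -- colliding scalars gives a nonzero d with G (d · x) = 0.
  kernel-meets-lines : ∀ {k} {G : Vec Carrier k → Carrier} {γ} → Additive G → (∀ x → G x ≢ γ) →
    ∀ x → ∃ λ d → d ≢ 0# × G (d · x) ≡ 0#
  kernel-meets-lines {G = G} additive G≢γ x
    with a , b , a≢b , eq ← non-surjective⇒collision (λ d → G (d · x)) (λ d → G≢γ (d · x))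
    = a + - b , a≢b ∘ x∙y⁻¹≈ε⇒x≈y a b , +-identityˡ-unique _ (G (b · x)) (begin
      G ((a + - b) · x) + G (b · x)    ≡⟨ additive _ _ ⟨
      G (((a + - b) · x) ⊕ (b · x))    ≡⟨ cong G (·-distribʳ (a + - b) b x) ⟨
      G ((a + - b + b) · x)            ≡⟨ cong (λ c → G (c · x)) (x-y+y≡x a b) ⟩
      G (a · x)                        ≡⟨ eq ⟩
      G (b · x)                        ∎)

  -- Additive maps miss some affine form

  module _ {k} (f : Vec Carrier (suc k) → Carrier) (f-additive : Additive f) where

    private
      V : List (Vec Carrier (suc k))
      V = vectors (suc k)

      hits : Vec Carrier (suc k) → Vec Carrier (suc k) → ℕ
      hits α x = 𝟙 (dot α x ≟ f x)

    residual : Vec Carrier (suc k) → Vec Carrier (suc k) → Carrier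
    residual α x = f x + - dot α x

    residual-additive : ∀ α → Additive (residual α)
    residual-additive α u v = begin
      f (u ⊕ v) + - dot α (u ⊕ v)              ≡⟨ cong₂ (λ s t → s + - t) (f-additive u v) (dot-⊕ʳ α u v) ⟩
      (f u + f v) + - (dot α u + dot α v)      ≡⟨ cong ((f u + f v) +_) (-‿+-comm _ _) ⟨
      (f u + f v) + (- dot α u + - dot α v)    ≡⟨ interchange (f u) (f v) _ _ ⟩
      residual α u + residual α v              ∎

    f-0v : f 0v ≡ 0#
    f-0v = +-identityʳ-unique (f 0v) (f 0v) (trans (sym (f-additive 0v 0v)) (cong f (⊕-identityʳ 0v)))

    -- If every f − α· were surjective, each would hit 0 exactly q^k times; but counting the pairs
    -- (α, x) with α·x = f x by x gives q^(k+1) for x = 0 and q^k for each other x, which is more.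
    ¬all-affine-forms-hit : ¬ (∀ α γ → ∃ λ x → f x ≡ dot α x + γ)
    ¬all-affine-forms-hit hit =
      ℕ.<-irrefl (sym (∑-cong V count-by-α)) (ℕ.<-≤-trans count-by-x (ℕ.≤-reflexive (sym (∑-comm V V hits))))
      where
      count-by-α : ∀ α → ∑[ x ∈ V ] hits α x ≡ q ℕ.^ k
      count-by-α α = trans
        (∑-cong V λ x → 𝟙-cong (dot α x ≟ f x) (residual α x ≟ 0#) (x≈y⇒x∙y⁻¹≈ε ∘ sym) (sym ∘ x∙y⁻¹≈ε⇒x≈y _ _))
        (#fibre-surjective (residual-additive α) residual-surjective 0#)
        where
        residual-surjective : ∀ γ → ∃ λ x → residual α x ≡ γ
        residual-surjective γ with x , fx≡αx+γ ← hit α γ = x , trans (cong (_+ - dot α x) fx≡αx+γ) (x+y-x≡y (dot α x) γ)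
      hits-at : Vec Carrier (suc k) → ℕ
      hits-at x = ∑[ α ∈ V ] hits α x
      hits-at-0v : hits-at 0v ≡ q ℕ.^ suc k
      hits-at-0v = begin
        ∑[ α ∈ V ] hits α 0v ≡⟨ ∑-cong V (λ α → 𝟙-yes (dot α 0v ≟ f 0v) (trans (dot-0ʳ α) (sym f-0v))) ⟩
        ∑[ α ∈ V ] 1         ≡⟨ ∑-const V 1 ⟩
        length V ℕ.* 1       ≡⟨ trans (ℕ.*-identityʳ _) (length-vectors (suc k)) ⟩
        q ℕ.^ suc k          ∎
      hits-at-≢0v : ∀ {x} → x ≢ 0v → hits-at x ≡ q ℕ.^ k
      hits-at-≢0v {x} x≢0 = #fibre-surjective (λ α β → dot-⊕ˡ α β x) (dot-surjective x≢0) (f x)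
      q^k<hits-at-0v : q ℕ.^ k ℕ.< hits-at 0v
      q^k<hits-at-0v = subst (q ℕ.^ k ℕ.<_) (sym hits-at-0v)
        (ℕ.<-≤-trans (ℕ.m<m*n (q ℕ.^ k) q {{ℕ.m^n≢0 q k}} 1<q) (ℕ.≤-reflexive (ℕ.*-comm (q ℕ.^ k) q)))
      q^k≤hits-at : ∀ x → q ℕ.^ k ℕ.≤ hits-at x
      q^k≤hits-at x with x ≟ⱽ 0v
      ... | yes refl = ℕ.<⇒≤ q^k<hits-at-0v
      ... | no x≢0 = ℕ.≤-reflexive (sym (hits-at-≢0v x≢0))
      count-by-x : ∑[ x ∈ V ] (q ℕ.^ k) ℕ.< ∑[ x ∈ V ] hits-at x
      count-by-x = ∑-mono-< V q^k≤hits-at (∈-vectors 0v) q^k<hits-at-0v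

    affine-form-avoided : ∃₂ λ α γ → ∀ x → f x ≢ dot α x + γ
    affine-form-avoided
      with ∃? ∈-vectors (λ α → ∃? complete (λ γ → ¬? (∃? ∈-vectors (λ x → f x ≟ (dot α x + γ)))))
    ... | yes (α , γ , ¬hit) = α , γ , λ x eq → ¬hit (x , eq)
    ... | no ¬avoided = ⊥-elim (¬all-affine-forms-hit λ α γ →
      decidable-stable (∃? ∈-vectors (λ x → f x ≟ (dot α x + γ))) (λ ¬hit → ¬avoided (α , γ , ¬hit)))

  -- The linear sets L_U and L_W

  module _ (n : ℕ) (f : Vec Carrier (suc n) → Carrier) (f-linear : IsFpLinear f) where

    LU LW : Vec Carrier (suc n ℕ.+ 2) → Set
    LU = InLinearSet (InU f)
    LW = InLinearSet (InW {n})

    ⟨_∣_∣_⟩ : Vec Carrier (suc n) → Carrier → Carrier → Vec Carrier (suc n ℕ.+ 2)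
    ⟨ x ∣ z ∣ t ⟩ = x Vec.++ (z ∷ t ∷ [])

    ⟨⟩-injective : ∀ {x x′ z z′ t t′} → ⟨ x ∣ z ∣ t ⟩ ≡ ⟨ x′ ∣ z′ ∣ t′ ⟩ →
      x ≡ x′ × z ≡ z′ × t ≡ t′
    ⟨⟩-injective {x} {x′} eq with Vec.++-injective x x′ eq
    ... | refl , refl = refl , refl , refl

    ⟨⟩-cong : ∀ {x x′ z z′ t t′} → x ≡ x′ → z ≡ z′ → t ≡ t′ →
      ⟨ x ∣ z ∣ t ⟩ ≡ ⟨ x′ ∣ z′ ∣ t′ ⟩
    ⟨⟩-cong refl refl refl = refl

    ·-⟨⟩ : ∀ c x z t → c · ⟨ x ∣ z ∣ t ⟩ ≡ ⟨ c · x ∣ c * z ∣ c * t ⟩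
    ·-⟨⟩ c x z t = ·-++ c x (z ∷ t ∷ [])

    0v-⟨⟩ : 0v ≡ ⟨ 0v ∣ 0# ∣ 0# ⟩
    0v-⟨⟩ = 0v-++ {suc n} {2}

    ⟨⟩≡0v : ∀ {x z t} → ⟨ x ∣ z ∣ t ⟩ ≡ 0v → x ≡ 0v × z ≡ 0# × t ≡ 0#
    ⟨⟩≡0v eq = ⟨⟩-injective {x′ = 0v} (trans eq 0v-⟨⟩)

    LW⇒last≡0 : ∀ {v} → LW v → ∃₂ λ x z → v ≡ ⟨ x ∣ z ∣ 0# ⟩
    LW⇒last≡0 (_ , _ , (x , y , _ , refl) , _ , c , refl) =
      c · x , c * y , trans (·-⟨⟩ c x y 0#) (⟨⟩-cong refl refl (zeroʳ c))

    last≡0⇒LW : ∀ {v x z} → Normalized v → v ≡ ⟨ x ∣ z ∣ 0# ⟩ → LW v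
    last≡0⇒LW {x = x} {z} nv refl with z ≟ 0#
    ... | yes refl = nv , ⟨ x ∣ 0# ∣ 0# ⟩ , (x , 0# , (0 , refl) , refl) , Normalized⇒≢0v nv , 1# , sym (·-identityˡ _)
    ... | no z≢0 = nv , ⟨ z ⁻¹ · x ∣ 1# ∣ 0# ⟩ , (z ⁻¹ · x , 1# , (1 , sym (+-identityʳ 1#)) , refl) ,
                   (λ eq → 1≢0 (proj₁ (proj₂ (⟨⟩≡0v eq)))) , z , sym (begin
      z · ⟨ z ⁻¹ · x ∣ 1# ∣ 0# ⟩          ≡⟨ ·-⟨⟩ z _ 1# 0# ⟩
      ⟨ z · (z ⁻¹ · x) ∣ z * 1# ∣ z * 0# ⟩
        ≡⟨ ⟨⟩-cong (·-inverse (⁻¹-inverseʳ z≢0) x) (*-identityʳ z) (zeroʳ z) ⟩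
      ⟨ x ∣ z ∣ 0# ⟩                       ∎)

    graph : Vec Carrier (suc n) → Vec Carrier (suc n ℕ.+ 2)
    graph x = ⟨ x ∣ f x ∣ 1# ⟩

    graph-InU : ∀ x → InU f (graph x)
    graph-InU x = x , 1# , (1 , sym (+-identityʳ 1#)) , refl

    graph≢0v : ∀ x → graph x ≢ 0v
    graph≢0v x eq = 1≢0 (proj₂ (proj₂ (⟨⟩≡0v eq)))

    -- A point of L_U outside L_W has nonzero last coordinate y ∈ 𝔽ₚ; scaling its U-vector by y⁻¹ ∈ 𝔽ₚ
    -- (which commutes with the 𝔽ₚ-linear f) gives a graph vector.
    LU∖LW⇒graph : ∀ {v} → LU v → ¬ LW v → ∃₂ λ x e → e ≢ 0# × v ≡ e · graph x
    LU∖LW⇒graph (nv , _ , (x , y , (k , refl) , refl) , _ , c , refl) ¬lw with (k ×1) ≟ 0#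
    ... | yes y≡0 =
      ⊥-elim (¬lw (last≡0⇒LW nv (trans (·-⟨⟩ c x (f x) _) (⟨⟩-cong refl refl (trans (cong (c *_) y≡0) (zeroʳ c))))))
    ... | no y≢0 with m , m∈𝔽ₚ , ym≡1 ← InPrimeField-inverse (k , refl) y≢0 = m · x , c * y , *-≢0 c≢0 y≢0 , (begin
      c · ⟨ x ∣ f x ∣ y ⟩                                    ≡⟨ ·-⟨⟩ c x (f x) y ⟩
      ⟨ c · x ∣ c * f x ∣ c * y ⟩                            ≡⟨ ⟨⟩-cong cx cfx (sym (*-identityʳ _)) ⟩
      ⟨ (c * y) · (m · x) ∣ c * y * f (m · x) ∣ c * y * 1# ⟩ ≡⟨ ·-⟨⟩ (c * y) (m · x) _ 1# ⟨
      (c * y) · graph (m · x)                               ∎)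
      where
      c≢0 : c ≢ 0#
      c≢0 c≡0 = Normalized⇒≢0v nv (trans (cong (_· _) c≡0) (·-zeroˡ _))
      cym≡c : c * y * m ≡ c
      cym≡c = trans (*-assoc c y m) (trans (cong (c *_) ym≡1) (*-identityʳ c))
      cx : c · x ≡ (c * y) · (m · x)
      cx = sym (trans (·-assoc (c * y) m x) (cong (_· x) cym≡c))
      cfx : c * f x ≡ c * y * f (m · x)
      cfx = sym (begin
        c * y * f (m · x)   ≡⟨ cong (c * y *_) (proj₂ f-linear m x m∈𝔽ₚ) ⟩
        c * y * (m * f x)   ≡⟨ *-assoc (c * y) m (f x) ⟨
        c * y * m * f x     ≡⟨ cong (_* f x) cym≡c ⟩
        c * f x             ∎)

    private
      scale : Vec Carrier (suc n) → Carrier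
      scale x = proj₁ (normalizer (graph x) (graph≢0v x))

      scale≢0 : ∀ x → scale x ≢ 0#
      scale≢0 x = proj₁ (proj₂ (normalizer (graph x) (graph≢0v x)))

    graph-point : Vec Carrier (suc n) → Vec Carrier (suc n ℕ.+ 2)
    graph-point x = scale x · graph x

    graph-point-Normalized : ∀ x → Normalized (graph-point x)
    graph-point-Normalized x = proj₂ (proj₂ (normalizer (graph x) (graph≢0v x)))

    graph-point-LU : ∀ x → LU (graph-point x)
    graph-point-LU x = graph-point-Normalized x , graph x , graph-InU x , graph≢0v x , scale x , refl

    graph-point-¬LW : ∀ x → ¬ LW (graph-point x)
    graph-point-¬LW x lw with _ , _ , eq ← LW⇒last≡0 lw =
      scale≢0 x (trans (sym (*-identityʳ _)) (proj₂ (proj₂ (⟨⟩-injective (trans (sym (·-⟨⟩ (scale x) x (f x) 1#)) eq)))))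

    graph-point-injective : ∀ {x x′} → graph-point x ≡ graph-point x′ → x ≡ x′
    graph-point-injective {x} {x′} eq
      with ex≡e′x′ , _ , e≡e′ ← ⟨⟩-injective (trans (sym (·-⟨⟩ (scale x) x (f x) 1#)) (trans eq (·-⟨⟩ (scale x′) x′ (f x′) 1#)))
      = ·-cancelˡ (scale≢0 x) (trans ex≡e′x′ (cong (_· x′) (sym (trans (sym (*-identityʳ _)) (trans e≡e′ (*-identityʳ _))))))

    ∈-graph-points : ∀ v → v ∈ List.map graph-point (vectors (suc n)) ⇔ (Normalized v × (LU v × ¬ LW v))
    ∈-graph-points v = mk⇔ to from
      where
      to : v ∈ List.map graph-point (vectors (suc n)) → Normalized v × (LU v × ¬ LW v)
      to ∈gps with x , _ , refl ← ∈-map⁻ graph-point ∈gps = graph-point-Normalized x , graph-point-LU x , graph-point-¬LW x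
      from : Normalized v × (LU v × ¬ LW v) → v ∈ List.map graph-point (vectors (suc n))
      from (nv , lu , ¬lw) with x , e , e≢0 , refl ← LU∖LW⇒graph lu ¬lw =
        subst (_∈ List.map graph-point (vectors (suc n))) (sym v≡graph-point) (∈-map⁺ graph-point (∈-vectors x))
        where
        v≡graph-point : e · graph x ≡ graph-point x
        v≡graph-point = normalized-proportional⇒≡ nv (graph-point-Normalized x)
          (sym (trans (·-assoc (e * scale x ⁻¹) (scale x) (graph x))
            (cong (_· graph x) (trans (*-assoc e _ _) (trans (cong (e *_) (⁻¹-inverseˡ (scale≢0 x))) (*-identityʳ e))))))

    size-LU∖LW : ∀ {a} → HasSize (λ v → LU v × ¬ LW v) a → a ≡ q ℕ.^ suc n
    size-LU∖LW size = HasSize-unique size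
      ( List.map graph-point (vectors (suc n))
      , Unique.map⁺ graph-point-injective (vectors-unique (suc n))
      , ∈-graph-points
      , trans (List.length-map graph-point (vectors (suc n))) (length-vectors (suc n)))

    private
      LW-points-x≢0 : List (Vec Carrier (suc n ℕ.+ 2))
      LW-points-x≢0 = cartesianProductWith (λ x z → ⟨ x ∣ z ∣ 0# ⟩) (points (suc n)) elements

    LW-points : List (Vec Carrier (suc n ℕ.+ 2))
    LW-points = LW-points-x≢0 ++ ⟨ 0v ∣ 1# ∣ 0# ⟩ ∷ []

    LW-points-unique : Unique LW-points
    LW-points-unique = Unique.++⁺
      (Unique.cartesianProductWith⁺ _ (λ eq → let x≡ , z≡ , _ = ⟨⟩-injective eq in x≡ , z≡) (points-unique (suc n)) unique)
      ([] ∷ []) disjoint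
      where
      disjoint : ∀ {v} → v ∈ LW-points-x≢0 × v ∈ ⟨ 0v ∣ 1# ∣ 0# ⟩ ∷ [] → ⊥
      disjoint (∈x≢0 , here refl) with x , _ , ∈points , _ , eq ← ∈-cartesianProductWith⁻ _ (points (suc n)) elements ∈x≢0 =
        Normalized⇒≢0v (Equivalence.to (∈-points⇔Normalized x) ∈points) (sym (proj₁ (⟨⟩-injective eq)))

    ∈-LW-points : ∀ v → v ∈ LW-points ⇔ (Normalized v × LW v)
    ∈-LW-points v = mk⇔ to from
      where
      to : v ∈ LW-points → Normalized v × LW v
      to ∈lw with ∈-++⁻ LW-points-x≢0 ∈lw
      ... | inj₁ ∈x≢0 with x , z , ∈points , _ , refl ← ∈-cartesianProductWith⁻ _ (points (suc n)) elements ∈x≢0 =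
        let nv = Equivalence.from (Normalized-++ x (z ∷ 0# ∷ [])) (inj₁ (Equivalence.to (∈-points⇔Normalized x) ∈points))
        in nv , last≡0⇒LW nv refl
      ... | inj₂ (here refl) =
        let nv = Equivalence.from (Normalized-++ (0v {suc n}) (1# ∷ 0# ∷ [])) (inj₂ (refl , inj₁ refl))
        in nv , last≡0⇒LW {x = 0v} {1#} nv refl
      from : Normalized v × LW v → v ∈ LW-points
      from (nv , lw) with x , z , refl ← LW⇒last≡0 lw with Equivalence.to (Normalized-++ x (z ∷ 0# ∷ [])) nv
      ... | inj₁ nx =
        ∈-++⁺ˡ (∈-cartesianProductWith⁺ (λ x z → ⟨ x ∣ z ∣ 0# ⟩) (Equivalence.from (∈-points⇔Normalized x) nx) (complete z))
      ... | inj₂ (refl , inj₁ refl) = ∈-++⁺ʳ _ (here refl)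
      ... | inj₂ (_ , inj₂ (_ , inj₁ 0≡1)) = ⊥-elim (0≢1 0≡1)

    size-LW : ∀ {m} → HasSize LW m → m ≡ q ℕ.^ suc n ℕ.+ q ℕ.^ n ℕ.+ length (points n)
    size-LW size = trans (HasSize-unique size (LW-points , LW-points-unique , ∈-LW-points , length-LW-points))
      (trans (cong (λ N → N ℕ.* q ℕ.+ 1) (length-points-suc n)) (geometric-step q≡1+[q∸1] (length-points n)))
      where
      length-LW-points : length LW-points ≡ length (points (suc n)) ℕ.* q ℕ.+ 1
      length-LW-points = trans (List.length-++ LW-points-x≢0)
        (cong (ℕ._+ 1) (length-cartesianProductWith _ (points (suc n)) elements))

    hyperplane-avoiding-L_U△L_W : ∃ λ a → a ≢ 0v × (∀ v → Normalized v →
      ((LU v × ¬ LW v) ⊎ (LW v × ¬ LU v)) → ¬ InHyperplane a v)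
    hyperplane-avoiding-L_U△L_W with α , γ , f≢α+γ ← affine-form-avoided f (proj₁ f-linear) =
      a , a≢0v , λ { v nv (inj₁ (lu , ¬lw)) → LU∖LW-off lu ¬lw ; v nv (inj₂ (lw , ¬lu)) → LW∖LU-off nv lw ¬lu }
      where
      a : Vec Carrier (suc n ℕ.+ 2)
      a = ⟨ α ∣ - 1# ∣ γ ⟩

      a≢0v : a ≢ 0v
      a≢0v eq = 0≢1 (x∙y⁻¹≈ε⇒x≈y 0# 1# (trans (+-identityˡ _) (proj₁ (proj₂ (⟨⟩≡0v eq)))))

      dot-a : ∀ x z t → dot a ⟨ x ∣ z ∣ t ⟩ ≡ dot α x + γ * t + - z
      dot-a x z t = begin
        dot a ⟨ x ∣ z ∣ t ⟩                 ≡⟨ dot-++ α x (- 1# ∷ γ ∷ []) (z ∷ t ∷ []) ⟩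
        dot α x + (- 1# * z + (γ * t + 0#)) ≡⟨ cong₂ (λ s u → dot α x + (s + u)) (-1*x≈-x z) (+-identityʳ _) ⟩
        dot α x + (- z + γ * t)            ≡⟨ cong (dot α x +_) (+-comm (- z) (γ * t)) ⟩
        dot α x + (γ * t + - z)            ≡⟨ +-assoc (dot α x) (γ * t) (- z) ⟨
        dot α x + γ * t + - z              ∎

      LU∖LW-off : ∀ {v} → LU v → ¬ LW v → ¬ InHyperplane a v
      LU∖LW-off lu ¬lw av≡0 with x , e , e≢0 , refl ← LU∖LW⇒graph lu ¬lw =
        f≢α+γ x (sym (trans (cong (dot α x +_) (sym (*-identityʳ γ)))
                              (x∙y⁻¹≈ε⇒x≈y _ _ (trans (sym (dot-a x (f x) 1#)) a·graph≡0))))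
        where
        a·graph≡0 : dot a (graph x) ≡ 0#
        a·graph≡0 = *-cancelˡ e≢0 (trans (sym (dot-·ʳ a e (graph x))) (trans av≡0 (sym (zeroʳ e))))

      -- A point ⟨x, z, 0⟩ on the hyperplane has z = α·x, and scaling x to a zero d·x of f − α·
      -- exhibits it as a point of L_U.
      LW∖LU-off : ∀ {v} → Normalized v → LW v → ¬ LU v → ¬ InHyperplane a v
      LW∖LU-off nv lw ¬lu av≡0 with x , z , refl ← LW⇒last≡0 lw =
        ¬lu (nv , u , (d · x , 0# , (0 , refl) , refl) , u≢0v , d ⁻¹ , v≡d⁻¹u)
        where
        z≡α·x : z ≡ dot α x
        z≡α·x = sym (trans (sym (trans (cong (dot α x +_) (zeroʳ γ)) (+-identityʳ _)))
                  (x∙y⁻¹≈ε⇒x≈y _ _ (trans (sym (dot-a x z 0#)) av≡0)))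
        x≢0v : x ≢ 0v
        x≢0v refl =
          Normalized⇒≢0v nv (trans (⟨⟩-cong {x = 0v} {t = 0#} refl (trans z≡α·x (dot-0ʳ α)) refl) (sym 0v-⟨⟩))
        kernel : ∃ λ d → d ≢ 0# × residual f (proj₁ f-linear) α (d · x) ≡ 0#
        kernel = kernel-meets-lines (residual-additive f (proj₁ f-linear) α)
          (λ y res≡γ → f≢α+γ y (trans (sym (x-y+y≡x (f y) (dot α y))) (trans (cong (_+ dot α y) res≡γ) (+-comm γ _)))) x
        d : Carrier
        d = proj₁ kernel
        d≢0 : d ≢ 0#
        d≢0 = proj₁ (proj₂ kernel)
        f[dx]≡dz : f (d · x) ≡ d * z
        f[dx]≡dz =
          trans (x∙y⁻¹≈ε⇒x≈y _ _ (proj₂ (proj₂ kernel))) (trans (dot-·ʳ α d x) (cong (d *_) (sym z≡α·x)))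
        u : Vec Carrier (suc n ℕ.+ 2)
        u = ⟨ d · x ∣ f (d · x) ∣ 0# ⟩
        u≢0v : u ≢ 0v
        u≢0v u≡0 = x≢0v (·-cancelˡ d≢0 (trans (proj₁ (⟨⟩≡0v u≡0)) (sym (·-zeroʳ d))))
        v≡d⁻¹u : ⟨ x ∣ z ∣ 0# ⟩ ≡ d ⁻¹ · u
        v≡d⁻¹u = sym (begin
          d ⁻¹ · u                                    ≡⟨ ·-⟨⟩ (d ⁻¹) (d · x) _ 0# ⟩
          ⟨ d ⁻¹ · (d · x) ∣ d ⁻¹ * f (d · x) ∣ d ⁻¹ * 0# ⟩
            ≡⟨ ⟨⟩-cong (·-inverse (⁻¹-inverseˡ d≢0) x) (trans (cong (d ⁻¹ *_) f[dx]≡dz) d⁻¹dz≡z) (zeroʳ _) ⟩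
          ⟨ x ∣ z ∣ 0# ⟩                              ∎)
          where
          d⁻¹dz≡z : d ⁻¹ * (d * z) ≡ z
          d⁻¹dz≡z = trans (sym (*-assoc _ d z)) (trans (cong (_* z) (⁻¹-inverseˡ d≢0)) (*-identityˡ z))


open import Data.Nat using (ℕ; suc; _+_; _*_; _∸_; _^_; _<_; NonZero; >-nonZero; nonTrivial⇒n>1)
open import Data.Nat.Properties using (∸-monoˡ-≤; m+[n∸m]≡n; <⇒≤)
open import Data.Nat.Primality using (Prime; prime⇒nonTrivial)
open import Data.Product using (∃; _×_; _,_; proj₁; proj₂)
open import Data.Sum using (_⊎_)
open import Data.Vec using (Vec)
open import Relation.Nullary using (¬_)
open import Relation.Binary.PropositionalEquality using (_≡_; _≢_; sym; trans; cong)
open import Function.Bundles using (_⇔_)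
open NatArithmetic using ([1+m]^n≡1+m*k; size-equivalence)
open Geometry

proposition3p3 : (F : FiniteField) → let module K = FiniteField F in
    (p h : ℕ) → Prime p → K.order ≡ p ^ h →
    (n : ℕ) → (f : Vec K.Carrier (suc n) → K.Carrier) → K.IsFpLinear f →
    let q = K.order
        LU = K.InLinearSet (K.InU f)
        LW = K.InLinearSet K.InW
    in
    (∃ λ a → a ≢ K.0v × (∀ v → K.Normalized v →
         ((LU v × ¬ LW v) ⊎ (LW v × ¬ LU v)) → ¬ K.InHyperplane a v))
    ×
    (∀ a b c →
       K.HasSize (λ v → LU v × ¬ LW v) a →
       K.HasSize (λ v → LW v × ¬ LU v) b →
       K.HasSize (λ v → LU v × LW v) c →
       ((a * 1 + b * (p ∸ 1) ≡ (p ∸ 1) * (q ^ (suc n) + q ^ n) + q ^ n)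
        ⇔ (c ≡ ((q ^ n * (q ∸ 1)) div (p ∸ 1)) + ((q ^ n ∸ 1) div (q ∸ 1)))))
proposition3p3 F p h p-prime q≡p^h n f f-linear =
  hyperplane-avoiding-L_U△L_W F n f f-linear ,
  λ a b c LU∖LW LW∖LU LU∩LW → size-equivalence {n = n} P R (1<q F) p≡1+P q≡1+PR
    (size-LU∖LW F n f f-linear LU∖LW)
    (size-LW F n f f-linear (HasSize-split F LU∩LW LW∖LU))
    (length-points F n)
  where
  P : ℕ
  P = p ∸ 1
  1<p : 1 < p
  1<p = nonTrivial⇒n>1 p {{prime⇒nonTrivial p-prime}}
  instance
    P-nonZero : NonZero P
    P-nonZero = >-nonZero (∸-monoˡ-≤ 1 1<p)
  p≡1+P : p ≡ suc P
  p≡1+P = sym (m+[n∸m]≡n (<⇒≤ 1<p))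
  R : ℕ
  R = proj₁ ([1+m]^n≡1+m*k P h)
  q≡1+PR : FiniteField.order F ≡ suc (P * R)
  q≡1+PR = trans q≡p^h (trans (cong (_^ h) p≡1+P) (proj₂ ([1+m]^n≡1+m*k P h)))
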